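{- Let $K_{a,b}$ be the complete bipartite graph with sides $L$ ($|L|=a$) and $R$ ($|R|=b$), let $\sigma$ be a confined position of the parallel chip-firing game on $K_{a,b}$, and let $t\ge1$. If $\alpha_t(L)=ka$ for some positive integer $k$, then $u_{t+1}(\sigma,v)-u_1(\sigma,v)=k$ for all $v\in R$.
   Context: Parallel chip-firing game: a position $\sigma$ assigns a nonnegative integer to each vertex; at each step every vertex $v$ with at least $\deg(v)$ chips simultaneously sends one chip to each neighbor. $U$ is the step operator. $\Phi_\sigma(v)$ is the number of neighbors $w$ of $v$ with $\sigma(w)\ge\deg(w)$. A position is confined if every vertex satisfies $\Phi_\sigma(v)\le\sigma(v)\le\Phi_\sigma(v)+\deg(v)-1$. $u_t(\sigma,v)=|\{s:0\le s<t,\ U^s\sigma(v)\ge\deg(v)\}|$. $\alpha_t(L)=\sum_{v\in L}u_t(\sigma,v)$. -}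

module Defs where

open import Data.Nat using (ℕ; zero; suc; _+_; _*_; _∸_; _≤_; _<_; _≥_; _≤?_)
open import Data.Fin using (Fin)
open import Data.Sum using (_⊎_; inj₁; inj₂)
open import Data.Bool using (Bool; true; false; if_then_else_)
open import Relation.Nullary.Decidable using (does)
open import Data.Product using (_×_)

-- Vertex set of K_{a,b}: left side L = Fin a (inj₁), right side R = Fin b (inj₂).
Vertex : ℕ → ℕ → Set
Vertex a b = Fin a ⊎ Fin b

Position : ℕ → ℕ → Set
Position a b = Vertex a b → ℕ

deg : {a b : ℕ} → Vertex a b → ℕ
deg {a} {b} (inj₁ _) = b
deg {a} {b} (inj₂ _) = a

sumFin : (n : ℕ) → (Fin n → ℕ) → ℕ
sumFin zero    f = 0
sumFin (suc n) f = f Fin.zero + sumFin n (λ i → f (Fin.suc i))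

fires : {a b : ℕ} → Position a b → Vertex a b → ℕ
fires σ v = if does (deg v ≤? σ v) then 1 else 0

-- Φ_σ(v): number of neighbours w of v with σ(w) ≥ deg(w).
-- Neighbours of a left vertex are exactly the right vertices and vice versa.
Φ : {a b : ℕ} → Position a b → Vertex a b → ℕ
Φ {a} {b} σ (inj₁ _) = sumFin b (λ j → fires σ (inj₂ j))
Φ {a} {b} σ (inj₂ _) = sumFin a (λ i → fires σ (inj₁ i))

U : {a b : ℕ} → Position a b → Position a b
U σ v = (σ v ∸ deg v * fires σ v) + Φ σ v

iterU : {a b : ℕ} → ℕ → Position a b → Position a b
iterU zero    σ = σ
iterU (suc s) σ = U (iterU s σ)

Confined : {a b : ℕ} → Position a b → Set
Confined σ = ∀ v → (Φ σ v ≤ σ v) × (σ v < Φ σ v + deg v)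

-- u_t(σ,v) = |{ s : 0 ≤ s < t, U^s σ (v) ≥ deg v }|
u : {a b : ℕ} → ℕ → Position a b → Vertex a b → ℕ
u zero    σ v = 0
u (suc t) σ v = u t σ v + fires (iterU t σ) v

αL : {a b : ℕ} → ℕ → Position a b → ℕ
αL {a} {b} t σ = sumFin a (λ i → u t σ (inj₁ i))

module Submission where

-- Fix a right vertex j of K_{a,b}; its chip count x_s = U^s σ (j)
-- evolves as  x_{s+1} = r_s + c_s,  where r_s = x_s − a·[x_s ≥ a] is what is left after
-- j (possibly) fires at time s, and c_s ≤ a is the number of left vertices firing at
-- time s (so Σ_{s<t} c_s = α_t(L)).  This is a "threshold counter":
--   * if x_0 < 2a then every residue r_t is < a (since x_{t+1} < a + a again), and
--   * chips are conserved:  x_0 + Σ_{s<t} c_s = r_t + a·(number of firings at times ≤ t).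
-- Confinement gives x_0 < Φ_σ(j) + a ≤ 2a.  Applying conservation at 0 and at t with
-- α_t(L) = k·a gives  r_t + a·u_{t+1} = r_0 + a·(u_1 + k)  with r_0, r_t < a, so uniqueness
-- of the quotient by a yields u_{t+1} = u_1 + k.

open import Defs
open import Data.Nat using (ℕ; zero; suc; _+_; _*_; _∸_; _≤_; _<_; _≥_; _≤?_; _≤ᵇ_; z≤n; s≤s; NonZero; >-nonZero)
open import Data.Nat.Properties
open import Data.Nat.DivMod using (_/_; +-distrib-/-∣ʳ; m<n⇒m/n≡0; m*n/n≡m)
open import Data.Nat.Divisibility using (n∣m*n)
open import Data.Nat.Solver using (module +-*-Solver)
open import Data.Fin using (Fin)
open import Data.Sum using (inj₁; inj₂)
open import Data.Product using (proj₂)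
open import Data.Bool using (true; false; if_then_else_)
open import Relation.Nullary using (does; ofʸ; ofⁿ)
open import Relation.Binary.PropositionalEquality using (_≡_; refl; sym; trans; cong; cong₂; subst; module ≡-Reasoning)
open +-*-Solver using (solve; _:=_; _:+_; _:*_)

-- The 0/1 indicator [d ≤ x]; `fires σ v` is definitionally `fireBit (deg v) (σ v)`.
-- (`does (d ≤? x)` computes to `d ≤ᵇ x`, so case splits below are on `d ≤ᵇ x`.)
fireBit : ℕ → ℕ → ℕ
fireBit d x = if does (d ≤? x) then 1 else 0

afterFiring : ℕ → ℕ → ℕ
afterFiring d x = x ∸ d * fireBit d x

fireBit≤1 : ∀ d x → fireBit d x ≤ 1
fireBit≤1 d x with d ≤ᵇ x
... | true  = s≤s z≤n
... | false = z≤n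

afterFiring+sent : ∀ d x → afterFiring d x + d * fireBit d x ≡ x
afterFiring+sent d x with d ≤ᵇ x | ≤ᵇ-reflects-≤ d x
... | true  | ofʸ d≤x rewrite *-identityʳ d = m∸n+n≡m d≤x
... | false | ofⁿ _   rewrite *-zeroʳ d = +-identityʳ x

afterFiring< : ∀ d x → x < d + d → afterFiring d x < d
afterFiring< d x x<2d with d ≤ᵇ x | ≤ᵇ-reflects-≤ d x
... | true  | ofʸ d≤x rewrite *-identityʳ d =
  +-cancelʳ-< _ _ d (subst (_< d + d) (sym (m∸n+n≡m d≤x)) x<2d)
... | false | ofⁿ d≰x rewrite *-zeroʳ d = ≰⇒> d≰x

quotient-unique : ∀ {d r s q q′} → r < d → s < d → r + d * q ≡ s + d * q′ → q ≡ q′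
quotient-unique {d} {r} {s} {q} {q′} r<d s<d eq = trans (sym (quotient r<d q)) (trans (cong (_/ d) eq) (quotient s<d q′))
  where
  instance
    d-nonZero : NonZero d
    d-nonZero = >-nonZero (≤-<-trans z≤n r<d)
  quotient : ∀ {m} → m < d → ∀ n → (m + d * n) / d ≡ n
  quotient {m} m<d n = begin
    (m + d * n) / d      ≡⟨ cong (λ e → (m + e) / d) (*-comm d n) ⟩
    (m + n * d) / d      ≡⟨ +-distrib-/-∣ʳ m (n∣m*n n) ⟩
    m / d + n * d / d    ≡⟨ cong₂ _+_ (m<n⇒m/n≡0 m<d) (m*n/n≡m n d) ⟩
    n                    ∎
    where open ≡-Reasoning

sumFin-≤ : ∀ n (f : Fin n → ℕ) → (∀ i → f i ≤ 1) → sumFin n f ≤ n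
sumFin-≤ zero    f f≤1 = z≤n
sumFin-≤ (suc n) f f≤1 = +-mono-≤ (f≤1 Fin.zero) (sumFin-≤ n (λ i → f (Fin.suc i)) (λ i → f≤1 (Fin.suc i)))

sumFin-zero : ∀ n → sumFin n (λ _ → 0) ≡ 0
sumFin-zero zero    = refl
sumFin-zero (suc n) = sumFin-zero n

sumFin-+ : ∀ n (f g : Fin n → ℕ) → sumFin n (λ i → f i + g i) ≡ sumFin n f + sumFin n g
sumFin-+ zero    f g = refl
sumFin-+ (suc n) f g rewrite sumFin-+ n (λ i → f (Fin.suc i)) (λ i → g (Fin.suc i)) =
  solve 4 (λ a b c e → (a :+ b) :+ (c :+ e) := (a :+ c) :+ (b :+ e)) refl (f Fin.zero) (g Fin.zero) _ _

-- A threshold counter: a vertex of degree d with x s chips at time s, receiving c s ≤ d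
-- chips at each step, fired F t times before time t, and received C t chips before time t.
module ThresholdCounter
  (d : ℕ) (x c F C : ℕ → ℕ)
  (x-step : ∀ s → x (suc s) ≡ afterFiring d (x s) + c s)
  (c≤d : ∀ s → c s ≤ d)
  (F-zero : F 0 ≡ 0) (F-step : ∀ s → F (suc s) ≡ F s + fireBit d (x s))
  (C-zero : C 0 ≡ 0) (C-step : ∀ s → C (suc s) ≡ C s + c s)
  where

  residue-bounded : x 0 < d + d → ∀ t → afterFiring d (x t) < d
  residue-bounded x₀<2d zero    = afterFiring< d (x 0) x₀<2d
  residue-bounded x₀<2d (suc t) = afterFiring< d (x (suc t))
    (subst (_< d + d) (sym (x-step t)) (+-mono-<-≤ (residue-bounded x₀<2d t) (c≤d t)))

  initial-split : x 0 ≡ afterFiring d (x 0) + d * F 1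
  initial-split = begin
    x 0                                       ≡⟨ sym (afterFiring+sent d (x 0)) ⟩
    afterFiring d (x 0) + d * fireBit d (x 0) ≡⟨ cong (λ n → afterFiring d (x 0) + d * n) (sym F-one) ⟩
    afterFiring d (x 0) + d * F 1             ∎
    where
    open ≡-Reasoning
    F-one : F 1 ≡ fireBit d (x 0)
    F-one = trans (F-step 0) (cong (_+ fireBit d (x 0)) F-zero)

  conservation : ∀ t → x 0 + C t ≡ afterFiring d (x t) + d * F (suc t)
  conservation zero = trans (cong (x 0 +_) C-zero) (trans (+-identityʳ (x 0)) initial-split)
  conservation (suc t) = begin
    x 0 + C (suc t)                           ≡⟨ cong (x 0 +_) (C-step t) ⟩
    x 0 + (C t + c t)                         ≡⟨ sym (+-assoc (x 0) (C t) (c t)) ⟩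
    x 0 + C t + c t                           ≡⟨ cong (_+ c t) (conservation t) ⟩
    r + d * F (suc t) + c t                   ≡⟨ shuffle r (d * F (suc t)) (c t) ⟩
    (r + c t) + d * F (suc t)                 ≡⟨ cong (_+ d * F (suc t)) (sym (x-step t)) ⟩
    x (suc t) + d * F (suc t)                 ≡⟨ cong (_+ d * F (suc t)) (sym (afterFiring+sent d (x (suc t)))) ⟩
    r′ + d * b + d * F (suc t)                ≡⟨ regroup r′ d b (F (suc t)) ⟩
    r′ + d * (F (suc t) + b)                  ≡⟨ cong (λ n → r′ + d * n) (sym (F-step (suc t))) ⟩
    r′ + d * F (suc (suc t))                  ∎
    where
    open ≡-Reasoning
    r  = afterFiring d (x t)
    r′ = afterFiring d (x (suc t))
    b  = fireBit d (x (suc t))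
    shuffle : ∀ p q e → p + q + e ≡ (p + e) + q
    shuffle = solve 3 (λ p q e → p :+ q :+ e := (p :+ e) :+ q) refl
    regroup : ∀ p m n f → p + m * n + m * f ≡ p + m * (f + n)
    regroup = solve 4 (λ p m n f → p :+ m :* n :+ m :* f := p :+ m :* (f :+ n)) refl

-- The theorem: the right vertex j is a threshold counter of degree a fed by the left side.
lemma3p3 : (a b : ℕ) → a ≥ 1 → b ≥ 1 → (σ : Position a b) → Confined σ
         → (t : ℕ) → t ≥ 1 → (k : ℕ) → k ≥ 1 → αL t σ ≡ k * a
         → (j : Fin b) → u (t + 1) σ (inj₂ j) ∸ u 1 σ (inj₂ j) ≡ k
lemma3p3 a b _ _ σ confined t _ k _ α≡ka j =
  begin
    u (t + 1) σ v ∸ u 1 σ v   ≡⟨ cong (λ n → u n σ v ∸ u 1 σ v) (+-comm t 1) ⟩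
    u (suc t) σ v ∸ u 1 σ v   ≡⟨ cong (_∸ u 1 σ v) fired-k-more ⟩
    u 1 σ v + k ∸ u 1 σ v     ≡⟨ m+n∸m≡n (u 1 σ v) k ⟩
    k                         ∎
  where
  open ≡-Reasoning
  v : Vertex a b
  v = inj₂ j
  received≤a : ∀ s → Φ (iterU s σ) v ≤ a
  received≤a s = sumFin-≤ a _ (λ i → fireBit≤1 b _)
  open ThresholdCounter a (λ s → iterU s σ v) (λ s → Φ (iterU s σ) v) (λ s → u s σ v) (λ s → αL s σ)
    (λ _ → refl) received≤a
    refl (λ _ → refl)
    (sumFin-zero a) (λ s → sumFin-+ a (λ i → u s σ (inj₁ i)) (λ i → fires (iterU s σ) (inj₁ i)))
  x₀<2a : σ v < a + a
  x₀<2a = <-≤-trans (proj₂ (confined v)) (+-monoˡ-≤ a (received≤a 0))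
  r₀ : ℕ
  r₀ = afterFiring a (σ v)
  both-expansions : afterFiring a (iterU t σ v) + a * u (suc t) σ v ≡ r₀ + a * (u 1 σ v + k)
  both-expansions = begin
    afterFiring a (iterU t σ v) + a * u (suc t) σ v   ≡⟨ sym (conservation t) ⟩
    σ v + αL t σ                                      ≡⟨ cong₂ _+_ initial-split (trans α≡ka (*-comm k a)) ⟩
    r₀ + a * u 1 σ v + a * k                           ≡⟨ +-assoc r₀ _ _ ⟩
    r₀ + (a * u 1 σ v + a * k)                         ≡⟨ cong (r₀ +_) (sym (*-distribˡ-+ a (u 1 σ v) k)) ⟩
    r₀ + a * (u 1 σ v + k)                             ∎
  fired-k-more : u (suc t) σ v ≡ u 1 σ v + k
  fired-k-more = quotient-unique (residue-bounded x₀<2a t) (residue-bounded x₀<2a 0) both-expansions
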